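{- Let $C$ be an arbitrary (possibly infinite) set and $F,G$ Plott functions on $C$. Then for every semi-stable pair $(Y,Z)$ there exists a stable pair $(Y',Z')$ with $Y\subseteq Y'$ and $Z'\subseteq Z$; for any stable pair $(Y',Z')$ the set $S=G(Y')=F(Z')$ is a stable set. In particular, a stable set for $(F,G)$ exists.
   Context: A choice function on a set $C$ is a map $G:2^C\to 2^C$ with $G(X)\subseteq X$ for all $X\subseteq C$; it is a Plott function if $G(X\cup Y)=G(G(X)\cup Y)$ for all $X,Y\subseteq C$. Given Plott functions $F,G$ on $C$: a pair $(Y,Z)$ of subsets of $C$ is semi-stable if $Y\cup Z=C$ and $G(Y)\subseteq F(Z)$, and a stable pair if $Y\cup Z=C$ and $G(Y)=F(Z)$. A subset $S\subseteq C$ is a stable set if (S1) $F(S)=S$ and $G(S)=S$, and (S2) for every $c\in C\setminus S$, either $c\notin F(S\cup\{c\})$ or $c\notin G(S\cup\{c\})$. (Note $(\emptyset,C)$ is a semi-stable pair.) -}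

module Defs where

open import Level using (0ℓ)
open import Data.Sum using (_⊎_)
open import Relation.Unary using (Pred; _⊆_; _∪_; _∉_; _≐_; ｛_｝; U)

Subset : Set → Set₁
Subset C = Pred C 0ℓ

-- A choice function on C: a map G : 2^C → 2^C with G(X) ⊆ X.
-- Since subsets are predicates, "being a map on 2^C" includes respecting
-- extensional equality of subsets (≐).
record ChoiceFunction (C : Set) (G : Subset C → Subset C) : Set₁ where
  field
    respects-≐ : ∀ {X Y : Subset C} → X ≐ Y → G X ≐ G Y
    contracting : ∀ (X : Subset C) → G X ⊆ X

record Plott (C : Set) (G : Subset C → Subset C) : Set₁ where
  field
    choice : ChoiceFunction C G
    path-independence : ∀ (X Y : Subset C) → G (X ∪ Y) ≐ G (G X ∪ Y)

SemiStablePair : {C : Set} (F G : Subset C → Subset C) → Subset C → Subset C → Set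
SemiStablePair F G Y Z = (U ⊆ Y ∪ Z) × (G Y ⊆ F Z)
  where open import Data.Product using (_×_)

StablePair : {C : Set} (F G : Subset C → Subset C) → Subset C → Subset C → Set
StablePair F G Y Z = (U ⊆ Y ∪ Z) × (G Y ≐ F Z)
  where open import Data.Product using (_×_)

StableSet : {C : Set} (F G : Subset C → Subset C) → Subset C → Set
StableSet {C} F G S =
  (F S ≐ S) × (G S ≐ S) ×
  (∀ (c : C) → c ∉ S → (c ∉ F (S ∪ ｛ c ｝)) ⊎ (c ∉ G (S ∪ ｛ c ｝)))
  where open import Data.Product using (_×_)

{-# OPTIONS --safe #-}
module Submission where

open import Defs
open import Level using (0ℓ; suc)
open import Axiom.ExcludedMiddle using (ExcludedMiddle)
open import Data.Empty using (⊥-elim)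
open import Data.Product using (_×_; _,_; proj₁; proj₂; Σ-syntax; ∃-syntax)
open import Data.Sum using (_⊎_; inj₁; inj₂)
open import Data.Unit using (tt)
open import Relation.Nullary using (yes; no)
open import Relation.Nullary.Decidable using (True; toWitness; fromWitness)
open import Relation.Unary using (_∈_; _∉_; _⊆_; _∪_; _∩_; _∖_; _≐_; ｛_｝; ∅; U; ∁)
open import Relation.Unary.Properties using (≐-sym; ≐-trans)
open import Relation.Binary.PropositionalEquality using (refl)

-- For a Plott function G write Z(Y) = ∁ Y ∪ G Y, and let Φ Y be the set of
-- c such that c ∈ Z(Y) implies c ∈ F(Z(Y)). Substitutability of G makes Z
-- antitone, hence (substitutability of F) Φ monotone. A semi-stable pair
-- (Y, Z) satisfies Z(Y) ⊆ Z and Y ⊆ Φ Y, so Y lies below the greatest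
-- fixed point Y* of Φ, and (Y*, Z(Y*)) is a stable pair with Z(Y*) ⊆ Z(Y) ⊆ Z.
-- For a stable pair (Y, Z) every c lies in Y or in Z, and adding c to
-- G Y = F Z is then rejected by G or by F respectively, by path independence.

module _ {C : Set} where

  ∪-cong-≐ˡ : {P Q R : Subset C} → P ≐ Q → P ∪ R ≐ Q ∪ R
  ∪-cong-≐ˡ (P⊆Q , Q⊆P) =
    (λ { (inj₁ p) → inj₁ (P⊆Q p) ; (inj₂ r) → inj₂ r })
    , (λ { (inj₁ q) → inj₁ (Q⊆P q) ; (inj₂ r) → inj₂ r })

  ∪-absorbʳ : {P Q : Subset C} → Q ⊆ P → P ∪ Q ≐ P
  ∪-absorbʳ Q⊆P = (λ { (inj₁ p) → p ; (inj₂ q) → Q⊆P q }) , inj₁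

  ∪-∖-split : ExcludedMiddle 0ℓ → {X Y : Subset C} → X ⊆ Y → Y ≐ X ∪ (Y ∖ X)
  ∪-∖-split em {X} {Y} X⊆Y = split , λ { (inj₁ x) → X⊆Y x ; (inj₂ (y , _)) → y }
    where
      split : Y ⊆ X ∪ (Y ∖ X)
      split {c} y with em {c ∈ X}
      ... | yes x = inj₁ x
      ... | no ¬x = inj₂ (y , ¬x)

-- em₁ is needed because the union of all post-fixed points quantifies over
-- Subset C : Set₁; deciding it squashes that union back into a Subset C.
module GreatestFixedPoint (em₁ : ExcludedMiddle (suc 0ℓ)) {C : Set}
  (T : Subset C → Subset C) (T-mono : ∀ {X Y} → X ⊆ Y → T X ⊆ T Y) where

  ν : Subset C
  ν c = True (em₁ {∃[ X ] (X ⊆ T X × c ∈ X)})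

  post-fixed⊆ν : ∀ {X} → X ⊆ T X → X ⊆ ν
  post-fixed⊆ν {X} X⊆TX x = fromWitness (X , (λ {c} → X⊆TX {c}) , x)

  ν-post-fixed : ν ⊆ T ν
  ν-post-fixed w with toWitness w
  ... | (X , X⊆TX , x) = T-mono (post-fixed⊆ν X⊆TX) (X⊆TX x)

  ν-pre-fixed : T ν ⊆ ν
  ν-pre-fixed = post-fixed⊆ν (T-mono ν-post-fixed)

module PlottProperties {C : Set} {H : Subset C → Subset C} (plott : Plott C H) where
  open Plott plott
  open ChoiceFunction choice

  idempotent : ∀ X → H (H X) ≐ H X
  idempotent X =
    ≐-trans (respects-≐ (≐-sym (∪-absorbʳ λ ())))
      (≐-trans (≐-sym (path-independence X ∅)) (respects-≐ (∪-absorbʳ λ ())))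

  ∪-singleton-rejected : ∀ X {c} → c ∈ X → H (H X ∪ ｛ c ｝) ⊆ H X
  ∪-singleton-rejected X {c} c∈X h =
    proj₁ (respects-≐ (∪-absorbʳ λ { refl → c∈X })) (proj₂ (path-independence X ｛ c ｝) h)

  substitutable : ExcludedMiddle 0ℓ → ∀ {X Y} → X ⊆ Y → X ∩ H Y ⊆ H X
  substitutable em {X} {Y} X⊆Y (x , x∈HY)
    with contracting _ (proj₁ (path-independence X (Y ∖ X))
                                (proj₁ (respects-≐ (∪-∖-split em X⊆Y)) x∈HY))
  ... | inj₁ x∈HX = x∈HX
  ... | inj₂ (_ , x∉X) = ⊥-elim (x∉X x)

module _ {C : Set} {F G : Subset C → Subset C} (plottF : Plott C F) (plottG : Plott C G) where
  private
    module F = PlottProperties plottF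
    module G = PlottProperties plottG
    open ChoiceFunction (Plott.choice plottF) using () renaming (respects-≐ to respectsF)

  stablePair⇒stableSet : ∀ {Y Z} → StablePair F G Y Z → StableSet F G (G Y)
  stablePair⇒stableSet {Y} {Z} (covers , GY≐FZ) =
    ≐-trans (respectsF GY≐FZ) (≐-trans (F.idempotent Z) (≐-sym GY≐FZ))
    , G.idempotent Y
    , rejected
    where
      rejected : ∀ c → c ∉ G Y → c ∉ F (G Y ∪ ｛ c ｝) ⊎ c ∉ G (G Y ∪ ｛ c ｝)
      rejected c c∉GY with covers {c} tt
      ... | inj₁ c∈Y = inj₂ λ c∈G → c∉GY (G.∪-singleton-rejected Y c∈Y c∈G)
      ... | inj₂ c∈Z = inj₁ λ c∈F →
        c∉GY (proj₂ GY≐FZ (F.∪-singleton-rejected Z c∈Z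
                              (proj₁ (respectsF (∪-cong-≐ˡ GY≐FZ)) c∈F)))

module StablePairConstruction (em : ExcludedMiddle 0ℓ) (em₁ : ExcludedMiddle (suc 0ℓ))
  {C : Set} {F G : Subset C → Subset C} (plottF : Plott C F) (plottG : Plott C G) where
  private
    module F = PlottProperties plottF
    module G = PlottProperties plottG
    open ChoiceFunction (Plott.choice plottF) using () renaming (contracting to contractingF)
    open ChoiceFunction (Plott.choice plottG) using () renaming (contracting to contractingG)

  Z[_] : Subset C → Subset C
  Z[ Y ] = ∁ Y ∪ G Y

  Φ : Subset C → Subset C
  Φ Y = ∁ Z[ Y ] ∪ F Z[ Y ]

  Z-antitone : ∀ {Y₁ Y₂} → Y₁ ⊆ Y₂ → Z[ Y₂ ] ⊆ Z[ Y₁ ]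
  Z-antitone Y₁⊆Y₂ (inj₁ c∉Y₂) = inj₁ λ c∈Y₁ → c∉Y₂ (Y₁⊆Y₂ c∈Y₁)
  Z-antitone {Y₁} Y₁⊆Y₂ {c} (inj₂ c∈GY₂) with em {c ∈ Y₁}
  ... | yes c∈Y₁ = inj₂ (G.substitutable em Y₁⊆Y₂ (c∈Y₁ , c∈GY₂))
  ... | no c∉Y₁ = inj₁ c∉Y₁

  Φ-monotone : ∀ {Y₁ Y₂} → Y₁ ⊆ Y₂ → Φ Y₁ ⊆ Φ Y₂
  Φ-monotone Y₁⊆Y₂ (inj₁ c∉Z₁) = inj₁ λ c∈Z₂ → c∉Z₁ (Z-antitone Y₁⊆Y₂ c∈Z₂)
  Φ-monotone {Y₁} {Y₂} Y₁⊆Y₂ {c} (inj₂ c∈FZ₁) with em {c ∈ Z[ Y₂ ]}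
  ... | yes c∈Z₂ = inj₂ (F.substitutable em (Z-antitone Y₁⊆Y₂) (c∈Z₂ , c∈FZ₁))
  ... | no c∉Z₂ = inj₁ c∉Z₂

  open GreatestFixedPoint em₁ Φ Φ-monotone public

  covered-by-Z : ∀ Y → U ⊆ Y ∪ Z[ Y ]
  covered-by-Z Y {c} _ with em {c ∈ Y}
  ... | yes c∈Y = inj₁ c∈Y
  ... | no c∉Y = inj₂ (inj₁ c∉Y)

  ν-stable : StablePair F G ν Z[ ν ]
  ν-stable = covered-by-Z ν , GY⊆FZ , FZ⊆GY
    where
      GY⊆FZ : G ν ⊆ F Z[ ν ]
      GY⊆FZ c∈G with ν-post-fixed (contractingG ν c∈G)
      ... | inj₁ c∉Z = ⊥-elim (c∉Z (inj₂ c∈G))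
      ... | inj₂ c∈F = c∈F
      FZ⊆GY : F Z[ ν ] ⊆ G ν
      FZ⊆GY c∈F with contractingF Z[ ν ] c∈F
      ... | inj₁ c∉ν = ⊥-elim (c∉ν (ν-pre-fixed (inj₂ c∈F)))
      ... | inj₂ c∈G = c∈G

  module _ {Y Z : Subset C} (covers : U ⊆ Y ∪ Z) (GY⊆FZ : G Y ⊆ F Z) where

    semiStable⇒Z⊆ : Z[ Y ] ⊆ Z
    semiStable⇒Z⊆ {c} (inj₁ c∉Y) with covers {c} tt
    ... | inj₁ c∈Y = ⊥-elim (c∉Y c∈Y)
    ... | inj₂ c∈Z = c∈Z
    semiStable⇒Z⊆ (inj₂ c∈GY) = contractingF Z (GY⊆FZ c∈GY)

    semiStable⇒post-fixed : Y ⊆ Φ Y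
    semiStable⇒post-fixed {c} c∈Y with em {c ∈ Z[ Y ]}
    ... | no c∉ZY = inj₁ c∉ZY
    ... | yes (inj₁ c∉Y) = ⊥-elim (c∉Y c∈Y)
    ... | yes (inj₂ c∈GY) =
      inj₂ (F.substitutable em semiStable⇒Z⊆ (inj₂ c∈GY , GY⊆FZ c∈GY))

    semiStable⇒stable-extension :
      Σ[ Y′ ∈ Subset C ] Σ[ Z′ ∈ Subset C ] (StablePair F G Y′ Z′ × Y ⊆ Y′ × Z′ ⊆ Z)
    semiStable⇒stable-extension =
      ν , Z[ ν ] , ν-stable , Y⊆ν , λ c∈Zν → semiStable⇒Z⊆ (Z-antitone Y⊆ν c∈Zν)
      where
        Y⊆ν : Y ⊆ ν
        Y⊆ν = post-fixed⊆ν semiStable⇒post-fixed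

mainTheorem7 : ExcludedMiddle 0ℓ → ExcludedMiddle (suc 0ℓ) →
    (C : Set) (F G : Subset C → Subset C) → Plott C F → Plott C G →
    ((Y Z : Subset C) → SemiStablePair F G Y Z →
      Σ[ Y′ ∈ Subset C ] Σ[ Z′ ∈ Subset C ]
        (StablePair F G Y′ Z′ × Y ⊆ Y′ × Z′ ⊆ Z))
    × ((Y′ Z′ : Subset C) → StablePair F G Y′ Z′ → StableSet F G (G Y′))
    × (Σ[ S ∈ Subset C ] StableSet F G S)
mainTheorem7 em em₁ C F G plottF plottG =
  (λ _ _ (covers , GY⊆FZ) → semiStable⇒stable-extension covers GY⊆FZ)
  , (λ _ _ → stablePair⇒stableSet plottF plottG)
  , (G ν , stablePair⇒stableSet plottF plottG ν-stable)
  where open StablePairConstruction em em₁ plottF plottG
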